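{- Let $G$ be a graph with $td(G)\ge 2$ and $F$ a partial MWIS-formula of $G$. If $I$ is a typical independent set of $F$ and $I$ intersects $\mathrm{Sep}(g)$ for each gate $g$ of $F$ with $|\mathrm{Sep}(g)|\ge td(G)/2$, then $F$ does not compute $I$.
   Context: $td(G)$ denotes treedepth: a treedepth decomposition of $G$ is a rooted forest on $V(G)$ in which the endpoints of every edge of $G$ are in ancestor–descendant relation; its depth is the maximum number of vertices on a root-to-leaf path; $td(G)$ is the minimum depth (the empty graph has treedepth $0$). A tropical formula over variables $X$ is a rooted tree of gates: leaves labeled by a variable of $X$ or the constant $0$, internal gates with exactly two children labeled $\max$ (sum gates) or $+$ (multiplication gates), root = output gate. Each gate $g$ computes a set of monomials (multisets of variables): a leaf $x$ gives $\{x\}$, a leaf $0$ the empty monomial, a sum gate the union of its children's sets, a multiplication gate all products of one monomial from each child. A partial MWIS-formula of $G$ is a tropical formula over $V(G)$ each of whose output monomials is $v_1\cdots v_l$ for an independent set $\{v_1,\dots,v_l\}$ of $G$ (distinct vertices). $\mathrm{Sup}(g)$ is the set of variables occurring in monomials computed by gate $g$. The formula computes an independent set $I$ if the monomial $\prod_{v\in I}v$ is among its output monomials. Separators: for the output gate $o$, $\mathrm{Sep}(o)=V(G)\setminus\mathrm{Sup}(o)$; if $g$ has a multiplication-gate parent $p$ then $\mathrm{Sep}(g)=\mathrm{Sep}(p)$; if $g$ has a sum-gate parent $p$ then $\mathrm{Sep}(g)=\mathrm{Sep}(p)\cup(\mathrm{Sup}(p)\setminus\mathrm{Sup}(g))$.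 An independent set $I$ of $G$ is a typical independent set of $F$ if for each multiplication gate $g$ of $F$ with $td(G[\mathrm{Sup}(g)])\ge td(G)/2$, the set $I$ intersects some connected component $C$ of $G[\mathrm{Sup}(g)]$ with $td(G[C])=td(G[\mathrm{Sup}(g)])$. -}

module Defs where

open import Data.Nat using (ℕ; zero; suc; _≤_; _*_)
open import Data.Bool using (Bool; true; false)
open import Data.Maybe using (Maybe; just; nothing)
open import Data.Fin using (Fin; _≟_)
open import Data.Fin.Subset using (Subset; _∈_; _⊆_; ∁; _∪_; _─_; ∣_∣; Nonempty; ⊤)
open import Data.Vec using (tabulate)
open import Data.List using (List; []; _∷_; [_]; _++_; map; concatMap)
open import Data.Bool.ListAction using (any)
import Data.List.Membership.Propositional as LM
open import Data.List.Relation.Unary.Unique.Propositional using (Unique)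
open import Data.Product using (Σ; ∃; _×_; _,_)
open import Data.Sum using (_⊎_)
open import Relation.Nullary using (¬_)
open import Data.Unit using () renaming (⊤ to Unit)
open import Data.Empty using () renaming (⊥ to Empty)
open import Relation.Nullary.Decidable using (⌊_⌋)
open import Relation.Binary.PropositionalEquality using (_≡_)

record Graph (n : ℕ) : Set where
  field
    adj     : Fin n → Fin n → Bool
    sym     : ∀ u v → adj u v ≡ adj v u
    irrefl  : ∀ v → adj v v ≡ false

open Graph public

module _ {n : ℕ} (G : Graph n) where

  Independent : Subset n → Set
  Independent I = ∀ u v → u ∈ I → v ∈ I → adj G u v ≡ false

  data Reach (S : Subset n) (u : Fin n) : Fin n → Set where
    here : u ∈ S → Reach S u u
    step : ∀ {w v} → Reach S u w → adj G w v ≡ true → v ∈ S → Reach S u v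

  IsComponent : Subset n → Subset n → Set
  IsComponent S C =
    C ⊆ S × Nonempty C × (∀ u v → u ∈ C → v ∈ C → Reach C u v)
    × (∀ u v → u ∈ C → v ∈ S → adj G u v ≡ true → v ∈ C)

data Anc {n : ℕ} (par : Fin n → Maybe (Fin n)) (u : Fin n) : Fin n → Set where
  parent : ∀ {v} → par v ≡ just u → Anc par u v
  up     : ∀ {w v} → par v ≡ just w → Anc par u w → Anc par u v

-- A treedepth decomposition of G[S]: a rooted forest on S (parent pointers,
-- with lvl v = number of vertices on the path from the root to v, which
-- also guarantees acyclicity), such that the endpoints of every edge of G[S]
-- are in ancestor-descendant relation.
record TDDecomp {n : ℕ} (G : Graph n) (S : Subset n) : Set where
  field
    par       : Fin n → Maybe (Fin n)
    lvl       : Fin n → ℕ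
    par-in    : ∀ v u → v ∈ S → par v ≡ just u → u ∈ S
    lvl-root  : ∀ v → par v ≡ nothing → lvl v ≡ 1
    lvl-par   : ∀ v u → par v ≡ just u → lvl v ≡ suc (lvl u)
    edges     : ∀ u v → u ∈ S → v ∈ S → adj G u v ≡ true →
                Anc par u v ⊎ Anc par v u

open TDDecomp public

DepthAtMost : ∀ {n} {G : Graph n} {S : Subset n} → TDDecomp G S → ℕ → Set
DepthAtMost {S = S} D k = ∀ v → v ∈ S → lvl D v ≤ k

IsTD : ∀ {n} → Graph n → Subset n → ℕ → Set
IsTD G S k = Σ (TDDecomp G S) (λ D → DepthAtMost D k)
           × (∀ (D : TDDecomp G S) j → DepthAtMost D j → k ≤ j)

data Formula (n : ℕ) : Set where
  var  : Fin n → Formula n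
  zer  : Formula n
  maxg : Formula n → Formula n → Formula n  -- sum gate
  plus : Formula n → Formula n → Formula n  -- multiplication gate

Monomial : ℕ → Set
Monomial n = List (Fin n)   -- multiset of variables, as a list

mons : ∀ {n} → Formula n → List (Monomial n)
mons (var x)    = [ [ x ] ]
mons zer        = [ [] ]
mons (maxg a b) = mons a ++ mons b
mons (plus a b) = concatMap (λ m → map (m ++_) (mons b)) (mons a)

Sup : ∀ {n} → Formula n → Subset n
Sup F = tabulate (λ v → any (λ m → any (λ w → ⌊ v ≟ w ⌋) m) (mons F))

-- gates of a formula, as positions (paths from the root)
data Pos {n : ℕ} : Formula n → Set where
  here   : ∀ {F} → Pos F
  maxL   : ∀ {a b} → Pos a → Pos (maxg a b)
  maxR   : ∀ {a b} → Pos b → Pos (maxg a b)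
  plusL  : ∀ {a b} → Pos a → Pos (plus a b)
  plusR  : ∀ {a b} → Pos b → Pos (plus a b)

gateAt : ∀ {n} (F : Formula n) → Pos F → Formula n
gateAt F here = F
gateAt (maxg a b) (maxL p) = gateAt a p
gateAt (maxg a b) (maxR p) = gateAt b p
gateAt (plus a b) (plusL p) = gateAt a p
gateAt (plus a b) (plusR p) = gateAt b p

IsMulGate : ∀ {n} → Formula n → Set
IsMulGate (plus _ _) = Unit
IsMulGate _          = Empty

-- Separators.  SepAt F s p: separator of gate p of F when the root of F
-- has separator s.
SepAt : ∀ {n} (F : Formula n) → Subset n → Pos F → Subset n
SepAt F s here = s
SepAt (maxg a b) s (maxL p) = SepAt a (s ∪ (Sup (maxg a b) ─ Sup a)) p
SepAt (maxg a b) s (maxR p) = SepAt b (s ∪ (Sup (maxg a b) ─ Sup b)) p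
SepAt (plus a b) s (plusL p) = SepAt a s p
SepAt (plus a b) s (plusR p) = SepAt b s p

Sep : ∀ {n} (F : Formula n) → Pos F → Subset n
Sep F p = SepAt F (∁ (Sup F)) p

module _ {n : ℕ} (G : Graph n) where

  MonomialOf : Monomial n → Subset n → Set
  MonomialOf m I = Unique m × (∀ v → (v LM.∈ m → v ∈ I) × (v ∈ I → v LM.∈ m))

  PartialMWIS : Formula n → Set
  PartialMWIS F = ∀ m → m LM.∈ mons F →
    Unique m × (∀ u v → u LM.∈ m → v LM.∈ m → adj G u v ≡ false)

  Computes : Formula n → Subset n → Set
  Computes F I = ∃ λ m → m LM.∈ mons F × MonomialOf m I

  Intersects : Subset n → Subset n → Set
  Intersects I S = ∃ λ v → v ∈ I × v ∈ S

  -- t is td(G)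
  Typical : ℕ → Formula n → Subset n → Set
  Typical t F I = Independent G I ×
    (∀ (p : Pos F) → IsMulGate (gateAt F p) →
      ∀ k → IsTD G (Sup (gateAt F p)) k → t ≤ 2 * k →
      ∃ λ C → IsComponent G (Sup (gateAt F p)) C × IsTD G C k × Intersects I C)

-- Follow the monomial ∏ I from the output gate downwards: at a sum gate into the child
-- computing it, at a product gate into both children.  Along the way I misses Sep(g) and
-- I ∩ Sup(g) lies in the current monomial, so by hypothesis every visited gate has
-- 2|Sep(g)| < t.  Bottom-up one then gets td(G[Sup g]) + |Sep g| < t: at a leaf Sup g has
-- at most one vertex and t ≥ 2; at a product gate the two supports are disjoint and
-- non-adjacent (F is a partial MWIS-formula) and the separator is inherited; at a sum gate
-- the vertices of Sup(parent) ∖ Sup(child) move from the separator into the support, each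
-- costing one new root.  At the output Sep = V ∖ Sup, so td(G) < t.

module Submission where

open import Defs hiding (sym)
open import Data.Nat using (ℕ; zero; suc; _≤_; _<_; _*_; _+_; _⊔_; z≤n; s≤s)
open import Data.Nat.Properties
  using (≤-refl; ≤-trans; ≤-reflexive; +-suc; +-assoc; +-comm; m≤m+n; +-monoʳ-≤;
         +-distribʳ-⊔; ⊔-lub; m≤m⊔n; m≤n⊔m; _≤?_; ≰⇒>; <⇒≱)
open import Data.Bool using (Bool; true; false)
open import Data.Bool.Properties using (T-≡)
open import Data.Maybe using (Maybe; just; nothing; _<∣>_)
open import Data.Fin using (Fin; _≟_)
open import Data.Fin.Subset using (Subset; _∈_; _∉_; _⊆_; ∁; _∪_; _─_; _-_; ∣_∣; ⁅_⁆; ⊤; ⊥; inside; outside)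
open import Data.Fin.Subset.Properties
  using (_∈?_; nonempty?; ⊆-antisym; x∈p∪q⁻; p⊆p∪q; q⊆p∪q; p─q⊆p; x∈p∧x∉q⇒x∈p─q;
         x∈⁅x⁆; x∈⁅y⁆⇒x≡y; x∈p⇒∣p-x∣<∣p∣; x∈∁p⇒x∉p; x∈p⇒x∉∁p; p∪∁p≡⊤;
         ∪-identityʳ; ∪-assoc; ∪-comm; Empty-unique)
open import Data.Vec using ([]; _∷_; here; there)
open import Data.Vec.Properties using (lookup∘tabulate; []=⇒lookup; lookup⇒[]=)
open import Data.List using (List; []; _∷_; _++_)
open import Data.Bool.ListAction using (any)
import Data.List.Membership.Propositional as L
open import Data.List.Membership.Propositional.Properties
  using (∈-++⁺ˡ; ∈-++⁺ʳ; ∈-++⁻; ∈-map⁺; ∈-map⁻; ∈-concatMap⁺; ∈-concatMap⁻)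
open import Data.List.Relation.Unary.Any as Any using (Any; here; there)
open import Data.List.Relation.Unary.Any.Properties using (any⇔)
import Data.List.Relation.Unary.All as All
import Data.List.Relation.Unary.All.Properties as All
open import Data.List.Relation.Unary.AllPairs using ([]; _∷_)
open import Data.List.Relation.Unary.Unique.Propositional using (Unique)
open import Data.Product using (∃; _×_; _,_; proj₁; proj₂)
open import Data.Sum using (_⊎_; inj₁; inj₂)
import Data.Sum
open import Function using (_∘_; _⇔_; Equivalence; mk⇔)
open import Relation.Nullary using (¬_; yes; no; contradiction)
open import Relation.Nullary.Decidable using (⌊_⌋; toWitness; fromWitness)
open import Relation.Binary.PropositionalEquality

private
  variable
    n : ℕ

Disjoint : Subset n → Subset n → Set
Disjoint p q = ∀ {v} → v ∈ p → v ∉ q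

x∈p─q⇒x∉q : ∀ {x : Fin n} (p q : Subset n) → x ∈ p ─ q → x ∉ q
x∈p─q⇒x∉q (_ ∷ p) (inside  ∷ q) (there x∈p─q) (there x∈q) = x∈p─q⇒x∉q p q x∈p─q x∈q
x∈p─q⇒x∉q (_ ∷ p) (outside ∷ q) (there x∈p─q) (there x∈q) = x∈p─q⇒x∉q p q x∈p─q x∈q

∣p∪q∣≡∣p∣+∣q∣ : (p q : Subset n) → Disjoint p q → ∣ p ∪ q ∣ ≡ ∣ p ∣ + ∣ q ∣
∣p∪q∣≡∣p∣+∣q∣ []            []            _   = refl
∣p∪q∣≡∣p∣+∣q∣ (inside  ∷ p) (inside  ∷ q) p#q = contradiction here (p#q here)
∣p∪q∣≡∣p∣+∣q∣ (inside  ∷ p) (outside ∷ q) p#q = cong suc (∣p∪q∣≡∣p∣+∣q∣ p q (λ x∈p → p#q (there x∈p) ∘ there))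
∣p∪q∣≡∣p∣+∣q∣ (outside ∷ p) (inside  ∷ q) p#q =
  trans (cong suc (∣p∪q∣≡∣p∣+∣q∣ p q (λ x∈p → p#q (there x∈p) ∘ there))) (sym (+-suc ∣ p ∣ ∣ q ∣))
∣p∪q∣≡∣p∣+∣q∣ (outside ∷ p) (outside ∷ q) p#q = ∣p∪q∣≡∣p∣+∣q∣ p q (λ x∈p → p#q (there x∈p) ∘ there)

p⊆q⇒p∪[q─p]≡q : {p q : Subset n} → p ⊆ q → p ∪ (q ─ p) ≡ q
p⊆q⇒p∪[q─p]≡q {p = p} {q} p⊆q = ⊆-antisym ⊆q q⊆
  where
  ⊆q : p ∪ (q ─ p) ⊆ q
  ⊆q x∈ with x∈p∪q⁻ p (q ─ p) x∈
  ... | inj₁ x∈p   = p⊆q x∈p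
  ... | inj₂ x∈q─p = p─q⊆p q p x∈q─p
  q⊆ : q ⊆ p ∪ (q ─ p)
  q⊆ {x} x∈q with x ∈? p
  ... | yes x∈p = p⊆p∪q (q ─ p) x∈p
  ... | no  x∉p = q⊆p∪q p (q ─ p) (x∈p∧x∉q⇒x∈p─q x∈q x∉p)

Unique-++⁻ : ∀ (xs : List (Fin n)) {ys} → Unique (xs ++ ys) →
             Unique xs × Unique ys × (∀ {v} → v L.∈ xs → v L.∉ ys)
Unique-++⁻ []       ys!              = [] , ys! , λ ()
Unique-++⁻ (x ∷ xs) (x∉xs++ys ∷ xs++ys!) with Unique-++⁻ xs xs++ys!
... | xs! , ys! , xs#ys = All.++⁻ˡ xs x∉xs++ys ∷ xs! , ys! , x∷xs#ys
  where
  x∷xs#ys : ∀ {v} → v L.∈ x ∷ xs → v L.∉ _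
  x∷xs#ys (here refl) v∈ys = All.lookup (All.++⁻ʳ xs x∉xs++ys) v∈ys refl
  x∷xs#ys (there v∈xs) = xs#ys v∈xs

∈-Sup⇔ : (F : Formula n) {v : Fin n} → v ∈ Sup F ⇔ Any (v L.∈_) (mons F)
∈-Sup⇔ F {v} = mk⇔ to from
  where
  indicator : Fin _ → Bool
  indicator u = any (λ m → any (λ w → ⌊ u ≟ w ⌋) m) (mons F)
  to : v ∈ Sup F → Any (v L.∈_) (mons F)
  to v∈ = Any.map (Any.map toWitness ∘ Equivalence.from any⇔)
            (Equivalence.from any⇔ (Equivalence.from T-≡
              (trans (sym (lookup∘tabulate indicator v))
                     ([]=⇒lookup v∈))))
  from : Any (v L.∈_) (mons F) → v ∈ Sup F
  from v∈mons = lookup⇒[]= v (Sup F)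
    (trans (lookup∘tabulate indicator v)
      (Equivalence.to T-≡ (Equivalence.to any⇔ (Any.map (Equivalence.to any⇔ ∘ Any.map fromWitness) v∈mons))))

∈-Sup⁺ : (F : Formula n) {m : Monomial n} {v : Fin n} → m L.∈ mons F → v L.∈ m → v ∈ Sup F
∈-Sup⁺ F m∈F v∈m = Equivalence.from (∈-Sup⇔ F) (L.lose m∈F v∈m)

∈-Sup⁻ : (F : Formula n) {v : Fin n} → v ∈ Sup F → ∃ λ m → m L.∈ mons F × v L.∈ m
∈-Sup⁻ F = L.find ∘ Equivalence.to (∈-Sup⇔ F)

∈-Sup-var : {x v : Fin n} → v ∈ Sup (var x) → v ≡ x
∈-Sup-var {x = x} v∈ with ∈-Sup⁻ (var x) v∈
... | _ , here refl , here v≡x = v≡x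

∉-Sup-zer : {v : Fin n} → v ∉ Sup zer
∉-Sup-zer v∈ with ∈-Sup⁻ zer v∈
... | _ , here refl , ()

∈-mons-plus⁺ : {a b : Formula n} {m₁ m₂ : Monomial n} →
               m₁ L.∈ mons a → m₂ L.∈ mons b → m₁ ++ m₂ L.∈ mons (plus a b)
∈-mons-plus⁺ m₁∈a m₂∈b = ∈-concatMap⁺ _ (L.lose m₁∈a (∈-map⁺ _ m₂∈b))

mons-nonempty : (F : Formula n) → ∃ λ m → m L.∈ mons F
mons-nonempty (var x)  = _ , here refl
mons-nonempty zer      = _ , here refl
mons-nonempty (maxg a b) = let m , m∈a = mons-nonempty a in m , ∈-++⁺ˡ m∈a
mons-nonempty (plus a b) =
  let m₁ , m₁∈a = mons-nonempty a ; m₂ , m₂∈b = mons-nonempty b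
  in m₁ ++ m₂ , ∈-mons-plus⁺ {a = a} {b} m₁∈a m₂∈b

module _ (a b : Formula n) where

  ∈-mons-plus⁻ : ∀ {m} → m L.∈ mons (plus a b) →
                 ∃ λ m₁ → ∃ λ m₂ → m₁ L.∈ mons a × m₂ L.∈ mons b × m ≡ m₁ ++ m₂
  ∈-mons-plus⁻ m∈ with L.find (∈-concatMap⁻ _ {xs = mons a} m∈)
  ... | m₁ , m₁∈a , m∈m₁b with ∈-map⁻ _ m∈m₁b
  ...   | m₂ , m₂∈b , m≡ = m₁ , m₂ , m₁∈a , m₂∈b , m≡

  Sup⊆Sup-maxgˡ : Sup a ⊆ Sup (maxg a b)
  Sup⊆Sup-maxgˡ v∈a = let m , m∈a , v∈m = ∈-Sup⁻ a v∈a in ∈-Sup⁺ (maxg a b) (∈-++⁺ˡ m∈a) v∈m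

  Sup⊆Sup-maxgʳ : Sup b ⊆ Sup (maxg a b)
  Sup⊆Sup-maxgʳ v∈b = let m , m∈b , v∈m = ∈-Sup⁻ b v∈b in ∈-Sup⁺ (maxg a b) (∈-++⁺ʳ (mons a) m∈b) v∈m

  Sup-plus : Sup (plus a b) ≡ Sup a ∪ Sup b
  Sup-plus = ⊆-antisym ⊆∪ ∪⊆
    where
    ⊆∪ : Sup (plus a b) ⊆ Sup a ∪ Sup b
    ⊆∪ v∈ with ∈-Sup⁻ (plus a b) v∈
    ... | m , m∈ , v∈m with ∈-mons-plus⁻ m∈
    ...   | m₁ , m₂ , m₁∈a , m₂∈b , refl with ∈-++⁻ m₁ v∈m
    ...     | inj₁ v∈m₁ = p⊆p∪q (Sup b) (∈-Sup⁺ a m₁∈a v∈m₁)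
    ...     | inj₂ v∈m₂ = q⊆p∪q (Sup a) (Sup b) (∈-Sup⁺ b m₂∈b v∈m₂)
    ∪⊆ : Sup a ∪ Sup b ⊆ Sup (plus a b)
    ∪⊆ v∈ with x∈p∪q⁻ (Sup a) (Sup b) v∈
    ... | inj₁ v∈a = let m₁ , m₁∈a , v∈m₁ = ∈-Sup⁻ a v∈a ; m₂ , m₂∈b = mons-nonempty b
                     in ∈-Sup⁺ (plus a b) (∈-mons-plus⁺ {a = a} {b} m₁∈a m₂∈b) (∈-++⁺ˡ v∈m₁)
    ... | inj₂ v∈b = let m₂ , m₂∈b , v∈m₂ = ∈-Sup⁻ b v∈b ; m₁ , m₁∈a = mons-nonempty a
                     in ∈-Sup⁺ (plus a b) (∈-mons-plus⁺ {a = a} {b} m₁∈a m₂∈b) (∈-++⁺ʳ m₁ v∈m₂)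

NoEdgeBetween : Graph n → Subset n → Subset n → Set
NoEdgeBetween G A B = ∀ {u v} → u ∈ A → v ∈ B → adj G u v ≡ false

module _ (G : Graph n) {a b : Formula n} (mwis : PartialMWIS G (plus a b)) where

  private
    mwis-++ : ∀ {m₁ m₂} → m₁ L.∈ mons a → m₂ L.∈ mons b →
              Unique (m₁ ++ m₂) × (∀ u v → u L.∈ m₁ ++ m₂ → v L.∈ m₁ ++ m₂ → adj G u v ≡ false)
    mwis-++ m₁∈a m₂∈b = mwis _ (∈-mons-plus⁺ {a = a} {b} m₁∈a m₂∈b)

  PartialMWIS-plusˡ : PartialMWIS G a
  PartialMWIS-plusˡ m m∈a =
    let m₂ , m₂∈b = mons-nonempty b
        m++m₂! , independent = mwis-++ m∈a m₂∈b
    in proj₁ (Unique-++⁻ m m++m₂!) , λ u v u∈m v∈m → independent u v (∈-++⁺ˡ u∈m) (∈-++⁺ˡ v∈m)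

  PartialMWIS-plusʳ : PartialMWIS G b
  PartialMWIS-plusʳ m m∈b =
    let m₁ , m₁∈a = mons-nonempty a
        m₁++m! , independent = mwis-++ m₁∈a m∈b
    in proj₁ (proj₂ (Unique-++⁻ m₁ m₁++m!)) , λ u v u∈m v∈m → independent u v (∈-++⁺ʳ m₁ u∈m) (∈-++⁺ʳ m₁ v∈m)

  Sup-plus-disjoint : Disjoint (Sup a) (Sup b)
  Sup-plus-disjoint v∈a v∈b =
    let m₁ , m₁∈a , v∈m₁ = ∈-Sup⁻ a v∈a ; m₂ , m₂∈b , v∈m₂ = ∈-Sup⁻ b v∈b
    in proj₂ (proj₂ (Unique-++⁻ m₁ (proj₁ (mwis-++ m₁∈a m₂∈b)))) v∈m₁ v∈m₂

  Sup-plus-no-edge : NoEdgeBetween G (Sup a) (Sup b)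
  Sup-plus-no-edge u∈a v∈b =
    let m₁ , m₁∈a , u∈m₁ = ∈-Sup⁻ a u∈a ; m₂ , m₂∈b , v∈m₂ = ∈-Sup⁻ b v∈b
    in proj₂ (mwis-++ m₁∈a m₂∈b) _ _ (∈-++⁺ˡ u∈m₁) (∈-++⁺ʳ m₁ v∈m₂)

Anc-transfer : {par par′ : Fin n → Maybe (Fin n)} (S : Subset n) →
               (∀ {v u} → v ∈ S → par v ≡ just u → u ∈ S) →
               (∀ {v u} → v ∈ S → par v ≡ just u → par′ v ≡ just u) →
               ∀ {u v} → v ∈ S → Anc par u v → Anc par′ u v
Anc-transfer S closed agree v∈S (parent e) = parent (agree v∈S e)
Anc-transfer S closed agree v∈S (up e a)   = up (agree v∈S e) (Anc-transfer S closed agree (closed v∈S e) a)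

module _ (G : Graph n) where

  TD≤ : Subset n → ℕ → Set
  TD≤ S k = ∃ λ (D : TDDecomp G S) → DepthAtMost D k

  TD≤-mono : ∀ {S j k} → j ≤ k → TD≤ S j → TD≤ S k
  TD≤-mono j≤k (D , depth) = D , λ v v∈S → ≤-trans (depth v v∈S) j≤k

  TD≤-edgeless : ∀ {S} → NoEdgeBetween G S S → TD≤ S 1
  TD≤-edgeless noEdge =
    record { par = λ _ → nothing ; lvl = λ _ → 1 ; par-in = λ _ _ _ ()
           ; lvl-root = λ _ _ → refl ; lvl-par = λ _ _ ()
           ; edges = λ u v u∈S v∈S e → contradiction (trans (sym e) (noEdge u∈S v∈S)) λ () }
    , λ _ _ → ≤-refl

  module Union {A B : Subset n} (DA : TDDecomp G A) (DB : TDDecomp G B)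
               (A#B : Disjoint A B) (A-B : NoEdgeBetween G A B) where

    par∪ : Fin n → Maybe (Fin n)
    par∪ v with v ∈? A | v ∈? B
    ... | yes _ | _     = par DA v
    ... | no _  | yes _ = par DB v
    ... | no _  | no _  = nothing

    lvl∪ : Fin n → ℕ
    lvl∪ v with v ∈? A | v ∈? B
    ... | yes _ | _     = lvl DA v
    ... | no _  | yes _ = lvl DB v
    ... | no _  | no _  = 1

    agreeᴬ : ∀ {v} → v ∈ A → par∪ v ≡ par DA v × lvl∪ v ≡ lvl DA v
    agreeᴬ {v} v∈A with v ∈? A | v ∈? B
    ... | yes _   | _ = refl , refl
    ... | no v∉A  | _ = contradiction v∈A v∉A

    agreeᴮ : ∀ {v} → v ∈ B → par∪ v ≡ par DB v × lvl∪ v ≡ lvl DB v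
    agreeᴮ {v} v∈B with v ∈? A | v ∈? B
    ... | yes v∈A | _       = contradiction v∈B (A#B v∈A)
    ... | no _    | yes _   = refl , refl
    ... | no _    | no v∉B  = contradiction v∈B v∉B

    par∪-in : ∀ v u → v ∈ A ∪ B → par∪ v ≡ just u → u ∈ A ∪ B
    par∪-in v u v∈ e with v ∈? A | v ∈? B
    ... | yes v∈A | _       = p⊆p∪q B (par-in DA v u v∈A e)
    ... | no _    | yes v∈B = q⊆p∪q A B (par-in DB v u v∈B e)
    ... | no _    | no _    = contradiction e λ ()

    lvl∪-root : ∀ v → par∪ v ≡ nothing → lvl∪ v ≡ 1
    lvl∪-root v e with v ∈? A | v ∈? B
    ... | yes _ | _     = lvl-root DA v e
    ... | no _  | yes _ = lvl-root DB v e
    ... | no _  | no _  = refl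

    lvl∪-par : ∀ v u → par∪ v ≡ just u → lvl∪ v ≡ suc (lvl∪ u)
    lvl∪-par v u e with v ∈? A | v ∈? B
    ... | yes v∈A | _       = trans (lvl-par DA v u e) (cong suc (sym (proj₂ (agreeᴬ (par-in DA v u v∈A e)))))
    ... | no _    | yes v∈B = trans (lvl-par DB v u e) (cong suc (sym (proj₂ (agreeᴮ (par-in DB v u v∈B e)))))
    ... | no _    | no _    = contradiction e λ ()

    Ancᴬ : ∀ {u v} → v ∈ A → Anc (par DA) u v → Anc par∪ u v
    Ancᴬ = Anc-transfer A (λ {v} {u} → par-in DA v u) (λ v∈A e → trans (proj₁ (agreeᴬ v∈A)) e)

    Ancᴮ : ∀ {u v} → v ∈ B → Anc (par DB) u v → Anc par∪ u v
    Ancᴮ = Anc-transfer B (λ {v} {u} → par-in DB v u) (λ v∈B e → trans (proj₁ (agreeᴮ v∈B)) e)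

    edges∪ : ∀ u v → u ∈ A ∪ B → v ∈ A ∪ B → adj G u v ≡ true → Anc par∪ u v ⊎ Anc par∪ v u
    edges∪ u v u∈ v∈ e with x∈p∪q⁻ A B u∈ | x∈p∪q⁻ A B v∈
    ... | inj₁ u∈A | inj₁ v∈A = Data.Sum.map (Ancᴬ v∈A) (Ancᴬ u∈A) (edges DA u v u∈A v∈A e)
    ... | inj₂ u∈B | inj₂ v∈B = Data.Sum.map (Ancᴮ v∈B) (Ancᴮ u∈B) (edges DB u v u∈B v∈B e)
    ... | inj₁ u∈A | inj₂ v∈B = contradiction (trans (sym e) (A-B u∈A v∈B)) λ ()
    ... | inj₂ u∈B | inj₁ v∈A = contradiction (trans (sym e) (trans (Graph.sym G u v) (A-B v∈A u∈B))) λ ()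

    decomp : TDDecomp G (A ∪ B)
    decomp = record { par = par∪ ; lvl = lvl∪ ; par-in = par∪-in ; lvl-root = lvl∪-root
                    ; lvl-par = lvl∪-par ; edges = edges∪ }

  TD≤-∪ : ∀ {A B ja jb} → Disjoint A B → NoEdgeBetween G A B →
          TD≤ A ja → TD≤ B jb → TD≤ (A ∪ B) (ja ⊔ jb)
  TD≤-∪ {A} {B} {ja} {jb} A#B A-B (DA , depthA) (DB , depthB) = decomp , depth
    where
    open Union DA DB A#B A-B
    depth : DepthAtMost decomp (ja ⊔ jb)
    depth v v∈ with x∈p∪q⁻ A B v∈
    ... | inj₁ v∈A = ≤-trans (≤-reflexive (proj₂ (agreeᴬ v∈A))) (≤-trans (depthA v v∈A) (m≤m⊔n ja jb))
    ... | inj₂ v∈B = ≤-trans (≤-reflexive (proj₂ (agreeᴮ v∈B))) (≤-trans (depthB v v∈B) (m≤n⊔m ja jb))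

  module AddRoot {S : Subset n} (D : TDDecomp G S) {r : Fin n} (r∉S : r ∉ S) where

    par⁺ : Fin n → Maybe (Fin n)
    par⁺ v with v ≟ r | v ∈? S
    ... | yes _ | _     = nothing
    ... | no _  | yes _ = par D v <∣> just r
    ... | no _  | no _  = nothing

    lvl⁺ : Fin n → ℕ
    lvl⁺ v with v ≟ r | v ∈? S
    ... | yes _ | _     = 1
    ... | no _  | yes _ = suc (lvl D v)
    ... | no _  | no _  = 1

    agree : ∀ {v} → v ∈ S → par⁺ v ≡ par D v <∣> just r × lvl⁺ v ≡ suc (lvl D v)
    agree {v} v∈S with v ≟ r | v ∈? S
    ... | yes refl | _      = contradiction v∈S r∉S
    ... | no _     | yes _  = refl , refl
    ... | no _     | no v∉S = contradiction v∈S v∉S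

    lvl⁺-r : lvl⁺ r ≡ 1
    lvl⁺-r with r ≟ r
    ... | yes _  = refl
    ... | no r≢r = contradiction refl r≢r

    <∣>r-just : ∀ {x u} → x <∣> just r ≡ just u → x ≡ just u ⊎ (x ≡ nothing × u ≡ r)
    <∣>r-just {just _}  refl = inj₁ refl
    <∣>r-just {nothing} refl = inj₂ (refl , refl)

    <∣>r≢nothing : ∀ x → x <∣> just r ≢ nothing
    <∣>r≢nothing (just _) ()
    <∣>r≢nothing nothing  ()

    par⁺-in : ∀ v u → v ∈ S ∪ ⁅ r ⁆ → par⁺ v ≡ just u → u ∈ S ∪ ⁅ r ⁆
    par⁺-in v u _ e with v ≟ r | v ∈? S
    ... | yes _ | _       = contradiction e λ ()
    ... | no _  | no _    = contradiction e λ ()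
    ... | no _  | yes v∈S with <∣>r-just e
    ...   | inj₁ e′         = p⊆p∪q ⁅ r ⁆ (par-in D v u v∈S e′)
    ...   | inj₂ (_ , refl) = q⊆p∪q S ⁅ r ⁆ (x∈⁅x⁆ r)

    lvl⁺-root : ∀ v → par⁺ v ≡ nothing → lvl⁺ v ≡ 1
    lvl⁺-root v e with v ≟ r | v ∈? S
    ... | yes _ | _     = refl
    ... | no _  | no _  = refl
    ... | no _  | yes _ = contradiction e (<∣>r≢nothing (par D v))

    lvl⁺-par : ∀ v u → par⁺ v ≡ just u → lvl⁺ v ≡ suc (lvl⁺ u)
    lvl⁺-par v u e with v ≟ r | v ∈? S
    ... | yes _ | _       = contradiction e λ ()
    ... | no _  | no _    = contradiction e λ ()
    ... | no _  | yes v∈S with <∣>r-just e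
    ...   | inj₁ e′          = cong suc (trans (lvl-par D v u e′) (sym (proj₂ (agree (par-in D v u v∈S e′)))))
    ...   | inj₂ (e′ , refl) = cong suc (trans (lvl-root D v e′) (sym lvl⁺-r))

    r-Anc : ∀ k {v} → v ∈ S → lvl D v ≤ k → Anc par⁺ r v
    r-Anc k {v} v∈S lv≤k with par D v in eq
    ... | nothing = parent (trans (proj₁ (agree v∈S)) (cong (_<∣> just r) eq))
    ... | just w with k | ≤-trans (≤-reflexive (sym (lvl-par D v w eq))) lv≤k
    ...   | suc k | s≤s lw≤k =
      up (trans (proj₁ (agree v∈S)) (cong (_<∣> just r) eq)) (r-Anc k (par-in D v w v∈S eq) lw≤k)

    AncS : ∀ {u v} → v ∈ S → Anc (par D) u v → Anc par⁺ u v
    AncS = Anc-transfer S (λ {v} {u} → par-in D v u)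
             (λ {v} v∈S e → trans (proj₁ (agree v∈S)) (cong (_<∣> just r) e))

    edges⁺ : ∀ u v → u ∈ S ∪ ⁅ r ⁆ → v ∈ S ∪ ⁅ r ⁆ → adj G u v ≡ true → Anc par⁺ u v ⊎ Anc par⁺ v u
    edges⁺ u v u∈ v∈ e with x∈p∪q⁻ S ⁅ r ⁆ u∈ | x∈p∪q⁻ S ⁅ r ⁆ v∈
    ... | inj₁ u∈S | inj₁ v∈S = Data.Sum.map (AncS v∈S) (AncS u∈S) (edges D u v u∈S v∈S e)
    ... | inj₂ u∈r | inj₁ v∈S rewrite x∈⁅y⁆⇒x≡y r u∈r = inj₁ (r-Anc _ v∈S ≤-refl)
    ... | inj₁ u∈S | inj₂ v∈r rewrite x∈⁅y⁆⇒x≡y r v∈r = inj₂ (r-Anc _ u∈S ≤-refl)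
    ... | inj₂ u∈r | inj₂ v∈r rewrite x∈⁅y⁆⇒x≡y r u∈r | x∈⁅y⁆⇒x≡y r v∈r =
      contradiction (trans (sym e) (irrefl G r)) λ ()

    decomp : TDDecomp G (S ∪ ⁅ r ⁆)
    decomp = record { par = par⁺ ; lvl = lvl⁺ ; par-in = par⁺-in ; lvl-root = lvl⁺-root
                    ; lvl-par = lvl⁺-par ; edges = edges⁺ }

  TD≤-addRoot : ∀ {S j r} → r ∉ S → TD≤ S j → TD≤ (S ∪ ⁅ r ⁆) (suc j)
  TD≤-addRoot {S} {j} {r} r∉S (D , depthD) = decomp , depth
    where
    open AddRoot D r∉S
    depth : DepthAtMost decomp (suc j)
    depth v v∈ with x∈p∪q⁻ S ⁅ r ⁆ v∈
    ... | inj₁ v∈S = ≤-trans (≤-reflexive (proj₂ (agree v∈S))) (s≤s (depthD v v∈S))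
    ... | inj₂ v∈r rewrite x∈⁅y⁆⇒x≡y r v∈r = ≤-trans (≤-reflexive lvl⁺-r) (s≤s z≤n)

  TD≤-∪ʳ : ∀ {S j} (R : Subset n) → Disjoint S R → TD≤ S j → TD≤ (S ∪ R) (j + ∣ R ∣)
  TD≤-∪ʳ R = go ∣ R ∣ R ≤-refl
    where
    go : ∀ k {S j} (R : Subset n) → ∣ R ∣ ≤ k → Disjoint S R → TD≤ S j → TD≤ (S ∪ R) (j + ∣ R ∣)
    go k {S} {j} R ∣R∣≤k S#R TD-S with nonempty? R
    ... | no R-empty rewrite Empty-unique R-empty | ∪-identityʳ S =
      TD≤-mono (m≤m+n j ∣ ⊥ {n} ∣) TD-S
    ... | yes (r , r∈R) with k | ≤-trans (x∈p⇒∣p-x∣<∣p∣ r∈R) ∣R∣≤k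
    ...   | suc k | s≤s ∣R-r∣≤k =
      subst (λ X → TD≤ X (j + ∣ R ∣)) S∪R-r∪r≡S∪R
        (TD≤-mono (≤-trans (≤-reflexive (sym (+-suc j ∣ R - r ∣))) (+-monoʳ-≤ j (x∈p⇒∣p-x∣<∣p∣ r∈R)))
          (TD≤-addRoot r∉ (go k (R - r) ∣R-r∣≤k (λ v∈S → S#R v∈S ∘ p─q⊆p R ⁅ r ⁆) TD-S)))
      where
      r∉ : r ∉ S ∪ (R - r)
      r∉ r∈ with x∈p∪q⁻ S (R - r) r∈
      ... | inj₁ r∈S   = S#R r∈S r∈R
      ... | inj₂ r∈R-r = x∈p─q⇒x∉q R ⁅ r ⁆ r∈R-r (x∈⁅x⁆ r)
      ⁅r⁆⊆R : ⁅ r ⁆ ⊆ R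
      ⁅r⁆⊆R v∈⁅r⁆ rewrite x∈⁅y⁆⇒x≡y r v∈⁅r⁆ = r∈R
      S∪R-r∪r≡S∪R : (S ∪ (R - r)) ∪ ⁅ r ⁆ ≡ S ∪ R
      S∪R-r∪r≡S∪R = begin
        (S ∪ (R - r)) ∪ ⁅ r ⁆  ≡⟨ ∪-assoc S (R - r) ⁅ r ⁆ ⟩
        S ∪ ((R - r) ∪ ⁅ r ⁆)  ≡⟨ cong (S ∪_) (∪-comm (R - r) ⁅ r ⁆) ⟩
        S ∪ (⁅ r ⁆ ∪ (R - r))  ≡⟨ cong (S ∪_) (p⊆q⇒p∪[q─p]≡q ⁅r⁆⊆R) ⟩
        S ∪ R                  ∎
        where open ≡-Reasoning

2≤t∧2*s<t⇒1+s<t : ∀ {t} s → 2 ≤ t → 2 * s < t → 1 + s < t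
2≤t∧2*s<t⇒1+s<t zero    2≤t _      = 2≤t
2≤t∧2*s<t⇒1+s<t (suc s) _   2*s<t =
  ≤-trans (s≤s (s≤s (≤-trans (s≤s (m≤m+n s (s + 0))) (≤-reflexive (sym (+-suc s (s + 0))))))) 2*s<t

module Trace (G : Graph n) (t : ℕ) (2≤t : 2 ≤ t) (I : Subset n) where

  record Fits (S s : Subset n) : Set where
    constructor fits
    field
      depth  : ℕ
      decomp : TD≤ G S depth
      bound  : depth + ∣ s ∣ < t

  Fits-edgeless : ∀ {S s} → NoEdgeBetween G S S → 2 * ∣ s ∣ < t → Fits S s
  Fits-edgeless {s = s} noEdge 2∣s∣<t = fits 1 (TD≤-edgeless G noEdge) (2≤t∧2*s<t⇒1+s<t ∣ s ∣ 2≤t 2∣s∣<t)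

  Fits-∪ : ∀ {A B s} → Disjoint A B → NoEdgeBetween G A B → Fits A s → Fits B s → Fits (A ∪ B) s
  Fits-∪ {s = s} A#B A-B (fits ja TD-A ja+s<t) (fits jb TD-B jb+s<t) =
    fits (ja ⊔ jb) (TD≤-∪ G A#B A-B TD-A TD-B)
      (≤-trans (≤-reflexive (cong suc (+-distribʳ-⊔ ∣ s ∣ ja jb))) (⊔-lub ja+s<t jb+s<t))

  Fits-absorb : ∀ {C R s} → Disjoint s R → Disjoint C R → Fits C (s ∪ R) → Fits (C ∪ R) s
  Fits-absorb {C} {R} {s} s#R C#R (fits j TD-C j+∣s∪R∣<t) =
    fits (j + ∣ R ∣) (TD≤-∪ʳ G R C#R TD-C) (≤-trans (≤-reflexive (cong suc count)) j+∣s∪R∣<t)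
    where
    count : j + ∣ R ∣ + ∣ s ∣ ≡ j + ∣ s ∪ R ∣
    count = begin
      j + ∣ R ∣ + ∣ s ∣    ≡⟨ +-assoc j ∣ R ∣ ∣ s ∣ ⟩
      j + (∣ R ∣ + ∣ s ∣)  ≡⟨ cong (j +_) (+-comm ∣ R ∣ ∣ s ∣) ⟩
      j + (∣ s ∣ + ∣ R ∣)  ≡⟨ cong (j +_) (∣p∪q∣≡∣p∣+∣q∣ s R s#R) ⟨
      j + ∣ s ∪ R ∣        ∎
      where open ≡-Reasoning

  Fits-sum : ∀ {C P s} → C ⊆ P → Disjoint s P → Fits C (s ∪ (P ─ C)) → Fits P s
  Fits-sum {C} {P} {s} C⊆P s#P C-fits =
    subst (λ X → Fits X s) (p⊆q⇒p∪[q─p]≡q C⊆P)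
      (Fits-absorb (λ v∈s → s#P v∈s ∘ p─q⊆p P C) (λ v∈C v∈P─C → x∈p─q⇒x∉q P C v∈P─C v∈C) C-fits)

  Fits-whole : ∀ {S} → Fits S (∁ S) → ∃ λ j → TD≤ G ⊤ j × j < t
  Fits-whole {S} (fits j TD-S j+∣∁S∣<t) =
    j + ∣ ∁ S ∣ ,
    subst (λ X → TD≤ G X (j + ∣ ∁ S ∣)) (p∪∁p≡⊤ S) (TD≤-∪ʳ G (∁ S) x∈p⇒x∉∁p TD-S) ,
    j+∣∁S∣<t

  small-separator : ∀ {s} → Disjoint I s → (t ≤ 2 * ∣ s ∣ → Intersects G I s) → 2 * ∣ s ∣ < t
  small-separator {s} I#s hits with t ≤? 2 * ∣ s ∣
  ... | yes t≤ = let _ , v∈I , v∈s = hits t≤ in contradiction v∈s (I#s v∈I)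
  ... | no t≰  = ≰⇒> t≰

  record Invariant (S s : Subset n) (m : Monomial n) : Set where
    field
      I#s   : Disjoint I s
      I∩S⊆m : ∀ {v} → v ∈ I → v ∈ S → v L.∈ m
      s#S   : Disjoint s S
  open Invariant

  Invariant-output : ∀ {F m} → m L.∈ mons F → MonomialOf G m I → Invariant (Sup F) (∁ (Sup F)) m
  Invariant-output {F} m∈F (_ , m⇔I) = record
    { I#s   = λ v∈I v∈∁ → x∈∁p⇒x∉p v∈∁ (∈-Sup⁺ F m∈F (proj₂ (m⇔I _) v∈I))
    ; I∩S⊆m = λ v∈I _ → proj₂ (m⇔I _) v∈I
    ; s#S   = x∈∁p⇒x∉p }

  Invariant-sum : ∀ {C P s m} → C ⊆ P → (∀ {v} → v L.∈ m → v ∈ C) →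
                  Invariant P s m → Invariant C (s ∪ (P ─ C)) m
  Invariant-sum {C} {P} {s} C⊆P m⊆C inv = record
    { I#s = I#s′ ; I∩S⊆m = λ v∈I → I∩S⊆m inv v∈I ∘ C⊆P ; s#S = s#S′ }
    where
    I#s′ : Disjoint I (s ∪ (P ─ C))
    I#s′ v∈I v∈ with x∈p∪q⁻ s (P ─ C) v∈
    ... | inj₁ v∈s   = I#s inv v∈I v∈s
    ... | inj₂ v∈P─C = x∈p─q⇒x∉q P C v∈P─C (m⊆C (I∩S⊆m inv v∈I (p─q⊆p P C v∈P─C)))
    s#S′ : Disjoint (s ∪ (P ─ C)) C
    s#S′ v∈ with x∈p∪q⁻ s (P ─ C) v∈
    ... | inj₁ v∈s   = s#S inv v∈s ∘ C⊆P
    ... | inj₂ v∈P─C = x∈p─q⇒x∉q P C v∈P─C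

  Invariant-plusˡ : ∀ {A B s m₁ m₂} → Disjoint A B → (∀ {v} → v L.∈ m₂ → v ∈ B) →
                    Invariant (A ∪ B) s (m₁ ++ m₂) → Invariant A s m₁
  Invariant-plusˡ {A} {B} {m₁ = m₁} A#B m₂⊆B inv = record
    { I#s = I#s inv ; I∩S⊆m = I∩A⊆m₁ ; s#S = λ v∈s → s#S inv v∈s ∘ p⊆p∪q B }
    where
    I∩A⊆m₁ : ∀ {v} → v ∈ I → v ∈ A → v L.∈ m₁
    I∩A⊆m₁ v∈I v∈A with ∈-++⁻ m₁ (I∩S⊆m inv v∈I (p⊆p∪q B v∈A))
    ... | inj₁ v∈m₁ = v∈m₁
    ... | inj₂ v∈m₂ = contradiction (m₂⊆B v∈m₂) (A#B v∈A)

  Invariant-plusʳ : ∀ {A B s m₁ m₂} → Disjoint A B → (∀ {v} → v L.∈ m₁ → v ∈ A) →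
                    Invariant (A ∪ B) s (m₁ ++ m₂) → Invariant B s m₂
  Invariant-plusʳ {A} {B} {m₁ = m₁} A#B m₁⊆A inv = record
    { I#s = I#s inv ; I∩S⊆m = I∩B⊆m₂ ; s#S = λ v∈s → s#S inv v∈s ∘ q⊆p∪q A B }
    where
    I∩B⊆m₂ : ∀ {v} → v ∈ I → v ∈ B → v L.∈ _
    I∩B⊆m₂ v∈I v∈B with ∈-++⁻ m₁ (I∩S⊆m inv v∈I (q⊆p∪q A B v∈B))
    ... | inj₁ v∈m₁ = contradiction v∈B (A#B (m₁⊆A v∈m₁))
    ... | inj₂ v∈m₂ = v∈m₂

  Sup-fits : ∀ (g : Formula n) s {m} → m L.∈ mons g → PartialMWIS G g → Invariant (Sup g) s m →
          (∀ p → t ≤ 2 * ∣ SepAt g s p ∣ → Intersects G I (SepAt g s p)) → Fits (Sup g) s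
  Sup-fits (var x) s _ _ inv hits = Fits-edgeless noEdge (small-separator (I#s inv) (hits here))
    where
    noEdge : NoEdgeBetween G (Sup (var x)) (Sup (var x))
    noEdge u∈ v∈ rewrite ∈-Sup-var u∈ | ∈-Sup-var v∈ = irrefl G x
  Sup-fits zer s _ _ inv hits =
    Fits-edgeless (λ u∈ → contradiction u∈ ∉-Sup-zer) (small-separator (I#s inv) (hits here))
  Sup-fits (maxg a b) s m∈ mwis inv hits with ∈-++⁻ (mons a) m∈
  ... | inj₁ m∈a = Fits-sum (Sup⊆Sup-maxgˡ a b) (s#S inv)
        (Sup-fits a _ m∈a (λ m′ → mwis m′ ∘ ∈-++⁺ˡ)
          (Invariant-sum (Sup⊆Sup-maxgˡ a b) (∈-Sup⁺ a m∈a) inv) (hits ∘ maxL))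
  ... | inj₂ m∈b = Fits-sum (Sup⊆Sup-maxgʳ a b) (s#S inv)
        (Sup-fits b _ m∈b (λ m′ → mwis m′ ∘ ∈-++⁺ʳ (mons a))
          (Invariant-sum (Sup⊆Sup-maxgʳ a b) (∈-Sup⁺ b m∈b) inv) (hits ∘ maxR))
  Sup-fits (plus a b) s m∈ mwis inv hits with ∈-mons-plus⁻ a b m∈
  ... | m₁ , m₂ , m₁∈a , m₂∈b , refl = subst (λ X → Fits X s) (sym (Sup-plus a b))
        (Fits-∪ a#b (Sup-plus-no-edge G {a} {b} mwis)
          (Sup-fits a s m₁∈a (PartialMWIS-plusˡ G {a} {b} mwis)
            (Invariant-plusˡ a#b (∈-Sup⁺ b m₂∈b) inv′) (hits ∘ plusL))
          (Sup-fits b s m₂∈b (PartialMWIS-plusʳ G {a} {b} mwis)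
            (Invariant-plusʳ a#b (∈-Sup⁺ a m₁∈a) inv′) (hits ∘ plusR)))
    where
    a#b : Disjoint (Sup a) (Sup b)
    a#b = Sup-plus-disjoint G {a} {b} mwis
    inv′ : Invariant (Sup a ∪ Sup b) s (m₁ ++ m₂)
    inv′ = subst (λ X → Invariant X s (m₁ ++ m₂)) (Sup-plus a b) inv

lemma23 : ∀ {n} (G : Graph n) (t : ℕ) → IsTD G ⊤ t → 2 ≤ t →
          (F : Formula n) → PartialMWIS G F →
          (I : Subset n) → Typical G t F I →
          (∀ (p : Pos F) → t ≤ 2 * ∣ Sep F p ∣ → Intersects G I (Sep F p)) →
          ¬ Computes G F I
lemma23 G t (_ , td-minimal) 2≤t F mwis I _ hits (m , m∈F , m-is-I) =
  let V-fits = Sup-fits F (∁ (Sup F)) m∈F mwis (Invariant-output {F = F} m∈F m-is-I) hits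
      j , (D , depth) , j<t = Fits-whole V-fits
  in <⇒≱ j<t (td-minimal D j depth)
  where open Trace G t 2≤t I
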